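{- Let $l\ge 0$ be an integer and let $\boldsymbol{\alpha}=(a_0,a_1,\dots)$ be a sequence with $a_k\in\{0,1\}=\mathbb{F}_2$, viewed as a row of the Proth–Gilbreath triangle, with $\phi(\boldsymbol{\alpha})=\sum_{k\ge0}a_kX^k\in\mathbb{F}_2[[X]]$. Then $\boldsymbol{\alpha}$ is ultimately replicated identically in the $l$-th row that follows $\boldsymbol{\alpha}$, namely $\Psi^{[l]}(\boldsymbol{\alpha})$, if and only if there exist an integer $r\ge 0$ and a polynomial $P_l(X)\in\mathbb{F}_2[X]$ such that $$\phi(\boldsymbol{\alpha})=\frac{P_l(X)}{(1+X)^l+X^r}\qquad\text{or}\qquad \phi(\boldsymbol{\alpha})=\frac{P_l(X)}{X^r(1+X)^l+1}.$$
   Context: $\Psi$ is the Proth–Gilbreath operator $(a_0,a_1,\dots)\mapsto(|a_1-a_0|,|a_2-a_1|,\dots)$ (for $0/1$ entries this is $(a_0+a_1,a_1+a_2,\dots)$ in $\mathbb{F}_2$), and $\Psi^{[l]}$ is its $l$-fold iterate ($\Psi^{[0]}$ the identity). A row $\boldsymbol{\beta}=(b_0,b_1,\dots)$ is "ultimately replicated identically" in a row $\boldsymbol{\gamma}=(c_0,c_1,\dots)$ if there exist integers $m,n\ge 0$ such that $b_{m+k}=c_{n+k}$ for all $k\ge 0$. An equality $\phi=P/D$ with $P,D\in\mathbb{F}_2[X]$ means $D(X)\phi=P(X)$ in $\mathbb{F}_2[[X]]$. -}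

module Defs where

open import Data.Bool using (Bool; true; false; _xor_; _∧_)
open import Data.Nat using (ℕ; zero; suc; _+_)
open import Data.List using (List; []; _∷_)
open import Relation.Binary.PropositionalEquality using (_≡_)
open import Data.Product using (∃₂)

-- A row of the Proth–Gilbreath triangle over F₂ = Bool (xor = addition).
Row : Set
Row = ℕ → Bool

-- Proth–Gilbreath operator: (Ψ a)_k = a_k + a_{k+1} in F₂ (= |a_{k+1} - a_k| for 0/1).
Ψ : Row → Row
Ψ a k = a k xor a (suc k)

Ψ^[_] : ℕ → Row → Row
Ψ^[ zero ] a = a
Ψ^[ suc l ] a = Ψ (Ψ^[ l ] a)

UltReplicated : Row → Row → Set
UltReplicated β γ = ∃₂ λ m n → ∀ k → β (m + k) ≡ γ (n + k)

Series : Set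
Series = ℕ → Bool

φ : Row → Series
φ a = a

-- Polynomials in F₂[X]: coefficient lists, lowest degree first.
Poly : Set
Poly = List Bool

coeff : Poly → ℕ → Bool
coeff [] k = false
coeff (c ∷ p) zero = c
coeff (c ∷ p) (suc k) = coeff p k

_+ₚ_ : Poly → Poly → Poly
[] +ₚ q = q
(c ∷ p) +ₚ [] = c ∷ p
(c ∷ p) +ₚ (d ∷ q) = (c xor d) ∷ (p +ₚ q)

scale : Bool → Poly → Poly
scale b [] = []
scale b (c ∷ p) = (b ∧ c) ∷ scale b p

_*ₚ_ : Poly → Poly → Poly
[] *ₚ q = []
(c ∷ p) *ₚ q = scale c q +ₚ (false ∷ (p *ₚ q))

oneₚ : Poly
oneₚ = true ∷ []

Xₚ : Poly
Xₚ = false ∷ true ∷ []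

_^ₚ_ : Poly → ℕ → Poly
p ^ₚ zero = oneₚ
p ^ₚ suc n = p *ₚ (p ^ₚ n)

_·ₛ_ : Poly → Series → Series
([] ·ₛ s) k = false
((d ∷ D) ·ₛ s) zero = d ∧ s zero
((d ∷ D) ·ₛ s) (suc k) = (d ∧ s (suc k)) xor (D ·ₛ s) k

-- φ = P / D  means  D φ = P in F₂[[X]]
_≡_/ₛ_ : Series → Poly → Poly → Set
s ≡ P /ₛ D = ∀ k → (D ·ₛ s) k ≡ coeff P k

-- Multiplication by X shifts a series, and multiplication by 1 + X applies Ψ after
-- that shift.  So for large N the coefficient of X^N in ((1 + X)^l + X^r) α is
-- Ψ^[l] α (N ∸ l) + α (N ∸ r), and in (X^r (1 + X)^l + 1) α it is
-- Ψ^[l] α (N ∸ r ∸ l) + α N.  A series is P / D for a polynomial P exactly when D times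
-- it is eventually zero, i.e. here when these two entries eventually agree.  A
-- replication α (m + k) = Ψ^[l] α (n + k) is of the first kind with r = n + l ∸ m when
-- m ≤ n + l, and of the second kind with r = m ∸ (n + l) otherwise.
module Submission where

open import Algebra using (CommutativeRing)
open import Data.Bool using (true; false; _xor_; _∧_)
open import Data.Bool.Properties
  using (xor-∧-commutativeRing; xor-comm; xor-same; xor-identityʳ;
         ∧-assoc; ∧-zeroʳ; ∧-distribˡ-xor; ∧-distribʳ-xor)
open import Data.List using ([]; _∷_; length)
open import Data.Nat using (ℕ; zero; suc; _+_)
open import Data.Nat.Properties using (+-assoc; +-suc; ≤-total; m≤n⇒∃[o]m+o≡n)
open import Data.Nat.Tactic.RingSolver using (solve-∀)
open import Data.Product using (∃; ∃₂; _,_)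
open import Data.Sum using (_⊎_; inj₁; inj₂)
open import Function using (_∘_)
open import Function.Bundles using (Equivalence; _⇔_; mk⇔)
open import Relation.Binary.PropositionalEquality
  using (_≡_; refl; sym; trans; cong; cong₂; subst; module ≡-Reasoning)

open import Defs

open import Algebra.Properties.CommutativeSemigroup
  (CommutativeRing.+-commutativeSemigroup xor-∧-commutativeRing) using (interchange)

open ≡-Reasoning

xor≡false⇒≡ : ∀ a b → a xor b ≡ false → a ≡ b
xor≡false⇒≡ false false _ = refl
xor≡false⇒≡ true  true  _ = refl

≡⇒xor≡false : ∀ {a b} → a ≡ b → a xor b ≡ false
≡⇒xor≡false {a} refl = xor-same a

+ₚ-·ₛ : ∀ p q s k → ((p +ₚ q) ·ₛ s) k ≡ (p ·ₛ s) k xor (q ·ₛ s) k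
+ₚ-·ₛ []      q       s k       = refl
+ₚ-·ₛ (c ∷ p) []      s k       = sym (xor-identityʳ _)
+ₚ-·ₛ (c ∷ p) (d ∷ q) s zero    = ∧-distribʳ-xor (s zero) c d
+ₚ-·ₛ (c ∷ p) (d ∷ q) s (suc k) = begin
  ((c xor d) ∧ s (suc k)) xor ((p +ₚ q) ·ₛ s) k
    ≡⟨ cong₂ _xor_ (∧-distribʳ-xor (s (suc k)) c d) (+ₚ-·ₛ p q s k) ⟩
  ((c ∧ s (suc k)) xor (d ∧ s (suc k))) xor ((p ·ₛ s) k xor (q ·ₛ s) k)
    ≡⟨ interchange (c ∧ s (suc k)) (d ∧ s (suc k)) ((p ·ₛ s) k) ((q ·ₛ s) k) ⟩
  ((c ∧ s (suc k)) xor (p ·ₛ s) k) xor ((d ∧ s (suc k)) xor (q ·ₛ s) k) ∎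

scale-·ₛ : ∀ b q s k → (scale b q ·ₛ s) k ≡ b ∧ (q ·ₛ s) k
scale-·ₛ b []      s k       = sym (∧-zeroʳ b)
scale-·ₛ b (c ∷ q) s zero    = ∧-assoc b c (s zero)
scale-·ₛ b (c ∷ q) s (suc k) = begin
  ((b ∧ c) ∧ s (suc k)) xor (scale b q ·ₛ s) k
    ≡⟨ cong₂ _xor_ (∧-assoc b c (s (suc k))) (scale-·ₛ b q s k) ⟩
  (b ∧ (c ∧ s (suc k))) xor (b ∧ (q ·ₛ s) k)
    ≡⟨ sym (∧-distribˡ-xor b _ _) ⟩
  b ∧ ((c ∧ s (suc k)) xor (q ·ₛ s) k) ∎

*ₚ-·ₛ : ∀ p q s k → ((p *ₚ q) ·ₛ s) k ≡ (p ·ₛ (q ·ₛ s)) k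
*ₚ-·ₛ []      q s k = refl
*ₚ-·ₛ (c ∷ p) q s zero
  rewrite +ₚ-·ₛ (scale c q) (false ∷ (p *ₚ q)) s zero | scale-·ₛ c q s zero
  = xor-identityʳ _
*ₚ-·ₛ (c ∷ p) q s (suc k)
  rewrite +ₚ-·ₛ (scale c q) (false ∷ (p *ₚ q)) s (suc k) | scale-·ₛ c q s (suc k)
        | *ₚ-·ₛ p q s k
  = refl

oneₚ-·ₛ : ∀ s k → (oneₚ ·ₛ s) k ≡ s k
oneₚ-·ₛ s zero    = refl
oneₚ-·ₛ s (suc k) = xor-identityʳ _

Xₚ-·ₛ : ∀ s k → (Xₚ ·ₛ s) (suc k) ≡ s k
Xₚ-·ₛ = oneₚ-·ₛ

[1+X]-·ₛ : ∀ s k → ((oneₚ +ₚ Xₚ) ·ₛ s) (suc k) ≡ Ψ s k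
[1+X]-·ₛ s k = trans (cong (s (suc k) xor_) (oneₚ-·ₛ s k)) (xor-comm (s (suc k)) (s k))

Xₚ^-·ₛ : ∀ r s j → ((Xₚ ^ₚ r) ·ₛ s) (r + j) ≡ s j
Xₚ^-·ₛ zero    s j = oneₚ-·ₛ s j
Xₚ^-·ₛ (suc r) s j = begin
  ((Xₚ *ₚ (Xₚ ^ₚ r)) ·ₛ s) (suc (r + j)) ≡⟨ *ₚ-·ₛ Xₚ (Xₚ ^ₚ r) s _ ⟩
  (Xₚ ·ₛ ((Xₚ ^ₚ r) ·ₛ s)) (suc (r + j)) ≡⟨ Xₚ-·ₛ _ (r + j) ⟩
  ((Xₚ ^ₚ r) ·ₛ s) (r + j)               ≡⟨ Xₚ^-·ₛ r s j ⟩
  s j                                     ∎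

[1+X]^-·ₛ : ∀ l s k → (((oneₚ +ₚ Xₚ) ^ₚ l) ·ₛ s) (l + k) ≡ Ψ^[ l ] s k
[1+X]^-·ₛ zero    s k = oneₚ-·ₛ s k
[1+X]^-·ₛ (suc l) s k = begin
  (((oneₚ +ₚ Xₚ) *ₚ ((oneₚ +ₚ Xₚ) ^ₚ l)) ·ₛ s) (suc (l + k))
    ≡⟨ *ₚ-·ₛ (oneₚ +ₚ Xₚ) ((oneₚ +ₚ Xₚ) ^ₚ l) s (suc (l + k)) ⟩
  ((oneₚ +ₚ Xₚ) ·ₛ t) (suc (l + k))
    ≡⟨ [1+X]-·ₛ t (l + k) ⟩
  t (l + k) xor t (suc (l + k))
    ≡⟨ cong₂ _xor_ ([1+X]^-·ₛ l s k)
                   (trans (cong t (sym (+-suc l k))) ([1+X]^-·ₛ l s (suc k))) ⟩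
  Ψ (Ψ^[ l ] s) k ∎
  where
  t : Series
  t = ((oneₚ +ₚ Xₚ) ^ₚ l) ·ₛ s

EventuallyZero : Series → Set
EventuallyZero s = ∃ λ M → ∀ j → s (M + j) ≡ false

truncate : ℕ → Series → Poly
truncate zero    s = []
truncate (suc M) s = s zero ∷ truncate M (s ∘ suc)

truncate-coeff : ∀ M s → (∀ j → s (M + j) ≡ false) → ∀ k → s k ≡ coeff (truncate M s) k
truncate-coeff zero    s tail k       = tail k
truncate-coeff (suc M) s tail zero    = refl
truncate-coeff (suc M) s tail (suc k) = truncate-coeff M (s ∘ suc) tail k

coeff-beyond-length : ∀ P j → coeff P (length P + j) ≡ false
coeff-beyond-length []      j = refl
coeff-beyond-length (c ∷ P) j = coeff-beyond-length P j

/ₛ⇔eventuallyZero : ∀ s D → (∃ λ P → s ≡ P /ₛ D) ⇔ EventuallyZero (D ·ₛ s)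
/ₛ⇔eventuallyZero s D = mk⇔
  (λ (P , h) → length P , λ j → trans (h (length P + j)) (coeff-beyond-length P j))
  (λ (M , tail) → truncate M (D ·ₛ s) , truncate-coeff M (D ·ₛ s) tail)

denom₁ denom₂ : ℕ → ℕ → Poly
denom₁ l r = ((oneₚ +ₚ Xₚ) ^ₚ l) +ₚ (Xₚ ^ₚ r)
denom₂ l r = ((Xₚ ^ₚ r) *ₚ ((oneₚ +ₚ Xₚ) ^ₚ l)) +ₚ oneₚ

denom₁-·ₛ : ∀ l r α {N i j} → l + i ≡ N → r + j ≡ N →
            (denom₁ l r ·ₛ α) N ≡ Ψ^[ l ] α i xor α j
denom₁-·ₛ l r α {i = i} {j} refl r+j≡N = begin
  (denom₁ l r ·ₛ α) (l + i)
    ≡⟨ +ₚ-·ₛ ((oneₚ +ₚ Xₚ) ^ₚ l) (Xₚ ^ₚ r) α (l + i) ⟩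
  (((oneₚ +ₚ Xₚ) ^ₚ l) ·ₛ α) (l + i) xor ((Xₚ ^ₚ r) ·ₛ α) (l + i)
    ≡⟨ cong₂ _xor_ ([1+X]^-·ₛ l α i)
                   (subst (λ N → ((Xₚ ^ₚ r) ·ₛ α) N ≡ α j) r+j≡N (Xₚ^-·ₛ r α j)) ⟩
  Ψ^[ l ] α i xor α j ∎

denom₂-·ₛ : ∀ l r α {N i} → r + (l + i) ≡ N →
            (denom₂ l r ·ₛ α) N ≡ Ψ^[ l ] α i xor α N
denom₂-·ₛ l r α {i = i} refl = begin
  (denom₂ l r ·ₛ α) N
    ≡⟨ +ₚ-·ₛ ((Xₚ ^ₚ r) *ₚ ((oneₚ +ₚ Xₚ) ^ₚ l)) oneₚ α N ⟩
  (((Xₚ ^ₚ r) *ₚ ((oneₚ +ₚ Xₚ) ^ₚ l)) ·ₛ α) N xor (oneₚ ·ₛ α) N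
    ≡⟨ cong₂ _xor_ (*ₚ-·ₛ (Xₚ ^ₚ r) _ α N) (oneₚ-·ₛ α N) ⟩
  ((Xₚ ^ₚ r) ·ₛ (((oneₚ +ₚ Xₚ) ^ₚ l) ·ₛ α)) N xor α N
    ≡⟨ cong (_xor α N) (trans (Xₚ^-·ₛ r _ (l + i)) ([1+X]^-·ₛ l α i)) ⟩
  Ψ^[ l ] α i xor α N ∎
  where
  N : ℕ
  N = r + (l + i)

module _ (l : ℕ) (α : Row) where

  replicated⇒eventuallyZero₁ : ∀ m n r → (∀ k → α (m + k) ≡ Ψ^[ l ] α (n + k)) →
                               m + r ≡ n + l → EventuallyZero (denom₁ l r ·ₛ α)
  replicated⇒eventuallyZero₁ m n r same m+r≡n+l = m + r , λ j → begin
    (denom₁ l r ·ₛ α) (m + r + j)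
      ≡⟨ denom₁-·ₛ l r α (trans (shuffle₁ l n j) (cong (_+ j) (sym m+r≡n+l))) (shuffle₂ r m j) ⟩
    Ψ^[ l ] α (n + j) xor α (m + j)
      ≡⟨ ≡⇒xor≡false (sym (same j)) ⟩
    false ∎
    where
    shuffle₁ : ∀ l n j → l + (n + j) ≡ n + l + j
    shuffle₁ = solve-∀
    shuffle₂ : ∀ r m j → r + (m + j) ≡ m + r + j
    shuffle₂ = solve-∀

  replicated⇒eventuallyZero₂ : ∀ m n r → (∀ k → α (m + k) ≡ Ψ^[ l ] α (n + k)) →
                               n + l + r ≡ m → EventuallyZero (denom₂ l r ·ₛ α)
  replicated⇒eventuallyZero₂ m n r same n+l+r≡m = m , λ j → begin
    (denom₂ l r ·ₛ α) (m + j)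
      ≡⟨ denom₂-·ₛ l r α (trans (shuffle r l n j) (cong (_+ j) n+l+r≡m)) ⟩
    Ψ^[ l ] α (n + j) xor α (m + j)
      ≡⟨ ≡⇒xor≡false (sym (same j)) ⟩
    false ∎
    where
    shuffle : ∀ r l n j → r + (l + (n + j)) ≡ n + l + r + j
    shuffle = solve-∀

  eventuallyZero₁⇒replicated : ∀ r → EventuallyZero (denom₁ l r ·ₛ α) →
                               UltReplicated α (Ψ^[ l ] α)
  eventuallyZero₁⇒replicated r (M , vanish) = M + l , M + r , λ k →
    sym (xor≡false⇒≡ _ _ (trans (sym (denom₁-·ₛ l r α (shuffle₁ l M r k) (shuffle₂ r M l k)))
                                (vanish (l + r + k))))
    where
    shuffle₁ : ∀ l M r k → l + (M + r + k) ≡ M + (l + r + k)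
    shuffle₁ = solve-∀
    shuffle₂ : ∀ r M l k → r + (M + l + k) ≡ M + (l + r + k)
    shuffle₂ = solve-∀

  eventuallyZero₂⇒replicated : ∀ r → EventuallyZero (denom₂ l r ·ₛ α) →
                               UltReplicated α (Ψ^[ l ] α)
  eventuallyZero₂⇒replicated r (M , vanish) = M + (r + l) , M , λ k → begin
    α (M + (r + l) + k)   ≡⟨ cong α (+-assoc M (r + l) k) ⟩
    α (M + (r + l + k))   ≡⟨ sym (xor≡false⇒≡ _ _ (trans (sym (denom₂-·ₛ l r α (shuffle r l M k)))
                                                         (vanish (r + l + k)))) ⟩
    Ψ^[ l ] α (M + k)     ∎
    where
    shuffle : ∀ r l M k → r + (l + (M + k)) ≡ M + (r + l + k)
    shuffle = solve-∀

  EventuallyZeroMultiple : Set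
  EventuallyZeroMultiple =
    ∃ λ r → EventuallyZero (denom₁ l r ·ₛ α) ⊎ EventuallyZero (denom₂ l r ·ₛ α)

  replicated⇔eventuallyZeroMultiple : UltReplicated α (Ψ^[ l ] α) ⇔ EventuallyZeroMultiple
  replicated⇔eventuallyZeroMultiple = mk⇔ to from
    where
    to : UltReplicated α (Ψ^[ l ] α) → EventuallyZeroMultiple
    to (m , n , same) with ≤-total m (n + l)
    ... | inj₁ m≤n+l = let r , m+r≡n+l = m≤n⇒∃[o]m+o≡n m≤n+l in
                       r , inj₁ (replicated⇒eventuallyZero₁ m n r same m+r≡n+l)
    ... | inj₂ n+l≤m = let r , n+l+r≡m = m≤n⇒∃[o]m+o≡n n+l≤m in
                       r , inj₂ (replicated⇒eventuallyZero₂ m n r same n+l+r≡m)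
    from : EventuallyZeroMultiple → UltReplicated α (Ψ^[ l ] α)
    from (r , inj₁ zero₁) = eventuallyZero₁⇒replicated r zero₁
    from (r , inj₂ zero₂) = eventuallyZero₂⇒replicated r zero₂

theorem6 : (l : ℕ) (α : Row) →
    UltReplicated α (Ψ^[ l ] α) ⇔
    (∃₂ λ (r : ℕ) (P : Poly) →
      (φ α ≡ P /ₛ (((oneₚ +ₚ Xₚ) ^ₚ l) +ₚ (Xₚ ^ₚ r)))
      ⊎ (φ α ≡ P /ₛ (((Xₚ ^ₚ r) *ₚ ((oneₚ +ₚ Xₚ) ^ₚ l)) +ₚ oneₚ)))
theorem6 l α = mk⇔ (rational ∘ to) (from ∘ eventuallyZero)
  where
  open Equivalence (replicated⇔eventuallyZeroMultiple l α)

  Rational : Set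
  Rational = ∃₂ λ r P → (α ≡ P /ₛ denom₁ l r) ⊎ (α ≡ P /ₛ denom₂ l r)

  quotient : ∀ D → EventuallyZero (D ·ₛ α) → ∃ λ P → α ≡ P /ₛ D
  quotient D = Equivalence.from (/ₛ⇔eventuallyZero α D)

  vanishing : ∀ D → (∃ λ P → α ≡ P /ₛ D) → EventuallyZero (D ·ₛ α)
  vanishing D = Equivalence.to (/ₛ⇔eventuallyZero α D)

  rational : EventuallyZeroMultiple l α → Rational
  rational (r , inj₁ zero₁) = let P , h = quotient (denom₁ l r) zero₁ in r , P , inj₁ h
  rational (r , inj₂ zero₂) = let P , h = quotient (denom₂ l r) zero₂ in r , P , inj₂ h

  eventuallyZero : Rational → EventuallyZeroMultiple l α
  eventuallyZero (r , P , inj₁ h) = r , inj₁ (vanishing (denom₁ l r) (P , h))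
  eventuallyZero (r , P , inj₂ h) = r , inj₂ (vanishing (denom₂ l r) (P , h))
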